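{- Let $\pi\in\mathcal A(n)$ have bounce path $p_{n,\alpha}$, with $\ell=\ell(\alpha)$. Then (1) $\pi\in\mathcal C(n)$; (2) $|\alpha_i-\alpha_{i+1}|\le1$ for all $1\le i<\ell$, and $\alpha_\ell=1$; (3) there are no indices $i<j<k$ with $\alpha_i<\alpha_j<\alpha_k$.
   Context: A Dyck path of semilength $n$ is a lattice path from $(0,0)$ to $(n,n)$ with unit north steps $\mathsf N$ and east steps $\mathsf E$ never going below $y=x$; $\mathcal D(n)$ is their set. The area $\mathbf a(\pi)$ is the number of whole unit cells between $\pi$ and the diagonal. With $h_i$ the $y$-coordinate of the east step of $\pi$ in column $i$ (strip $i-1\le x\le i$), the bounce points are $b_0=0$, $b_k=h_{b_{k-1}+1}$ until $b_m=n$; the bounce composition is $\alpha_k=b_k-b_{k-1}$; the bounce path is $p_{n,\alpha}=\mathsf N^{\alpha_1}\mathsf E^{\alpha_1}\cdots\mathsf N^{\alpha_m}\mathsf E^{\alpha_m}$; the bounce is $\mathbf b(\pi)=\sum_{k=1}^m(n-b_k)$. $\mathcal C(n)=\{p_{n,\alpha}:\alpha\text{ composition of }n\}$. $\mathcal A(n)$ is the set of $\pi\in\mathcal D(n)$ such that $\mathbf a(\tau)\ge\mathbf a(\pi)$ for every $\tau\in\mathcal D(n)$ with $\mathbf a(\tau)+\mathbf b(\tau)=\mathbf a(\pi)+\mathbf b(\pi)$. -}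

module Defs where

open import Data.Nat using (ℕ; zero; suc; _+_; _∸_; _≤_; _<_; ∣_-_∣)
open import Data.Nat.Properties using (_≟_)
open import Data.List using (List; []; _∷_; _++_; replicate; length; map; concatMap; lookup)
open import Data.Nat.ListAction using (sum)
open import Data.List.Relation.Unary.All using (All)
open import Data.Fin using (Fin; toℕ)
open import Data.Product using (_×_; ∃; ∃-syntax; Σ-syntax)
open import Data.Empty using (⊥)
open import Relation.Nullary using (¬_; yes; no)
open import Relation.Binary.PropositionalEquality using (_≡_)

data Step : Set where
  N E : Step

-- Ballot k s : starting k units above the diagonal, the path s never goes
-- below the diagonal y = x and ends on it.
Ballot : ℕ → List Step → Set
Ballot k [] = k ≡ 0
Ballot k (N ∷ s) = Ballot (suc k) s
Ballot zero (E ∷ s) = ⊥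
Ballot (suc k) (E ∷ s) = Ballot k s

IsDyck : ℕ → List Step → Set
IsDyck n π = (length π ≡ n + n) × Ballot 0 π

-- heightsFrom y s : the y-coordinates of the east steps of s (in order of
-- columns), when s starts at height y.  For a Dyck path, this is h_1,…,h_n.
heightsFrom : ℕ → List Step → List ℕ
heightsFrom y [] = []
heightsFrom y (N ∷ s) = heightsFrom (suc y) s
heightsFrom y (E ∷ s) = y ∷ heightsFrom y s

heights : List Step → List ℕ
heights = heightsFrom 0

-- h_{i+1} (0-indexed access with default 0)
at : List ℕ → ℕ → ℕ
at [] _ = 0
at (x ∷ xs) zero = x
at (x ∷ xs) (suc i) = at xs i

-- Area: number of whole cells between π and the diagonal = Σ_i (h_i − i).
areaFrom : ℕ → List ℕ → ℕ
areaFrom i [] = 0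
areaFrom i (h ∷ hs) = (h ∸ suc i) + areaFrom (suc i) hs

area : List Step → ℕ
area π = areaFrom 0 (heights π)

-- Bounce points b_1,…,b_m (starting from b = b_0), via b_k = h_{b_{k-1}+1},
-- stopping when b = n.  Fuel: each step increases b by ≥ 1, so n steps suffice.
bouncePtsGo : ℕ → List ℕ → ℕ → ℕ → List ℕ
bouncePtsGo n hs zero b = []
bouncePtsGo n hs (suc f) b with b ≟ n
... | yes _ = []
... | no _ = at hs b ∷ bouncePtsGo n hs f (at hs b)

bouncePoints : ℕ → List Step → List ℕ
bouncePoints n π = bouncePtsGo n (heights π) n 0

bounce : ℕ → List Step → ℕ
bounce n π = sum (map (n ∸_) (bouncePoints n π))

diffs : ℕ → List ℕ → List ℕ
diffs b [] = []
diffs b (c ∷ cs) = (c ∸ b) ∷ diffs c cs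

bounceComp : ℕ → List Step → List ℕ
bounceComp n π = diffs 0 (bouncePoints n π)

IsComposition : ℕ → List ℕ → Set
IsComposition n α = All (λ a → 1 ≤ a) α × sum α ≡ n

bouncePath : List ℕ → List Step
bouncePath = concatMap (λ a → replicate a N ++ replicate a E)

InC : ℕ → List Step → Set
InC n π = ∃[ α ] (IsComposition n α × π ≡ bouncePath α)

InA : ℕ → List Step → Set
InA n π = IsDyck n π ×
  ((τ : List Step) → IsDyck n τ →
     area τ + bounce n τ ≡ area π + bounce n π → area π ≤ area τ)

{-# OPTIONS --safe #-}
-- For a composition α of n, a Dyck path with bounce composition α has bounce
-- bounceᶜ α and area between areaᶜ α, attained only by p_{n,α}, and
-- areaᶜ α + slackᶜ α, where areaᶜ α + bounceᶜ α + slackᶜ α = triangle n = n(n − 1)/2.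
-- Every value below slackᶜ β is the slack of a composition of the same number with
-- larger bounce; iterating, every value of area + bounce from areaᶜ β + bounceᶜ β up
-- to triangle n is attained by a bounce path of area at most areaᶜ β.  Comparing
-- π ∈ 𝒜(n) with these bounce paths gives area π = areaᶜ α, hence π = p_{n,α}, and
-- shows that no composition of n has smaller area and no larger area + bounce than α.
-- Local moves would produce such a composition if α violated (2) or (3): shifting a
-- unit from a part to an earlier part at least two smaller, or to the next part if
-- that is at least two smaller, or splitting a last part a ≥ 2 into a − 1, 1.

module Submission where

open import Defs
open import Data.Nat using (ℕ; zero; suc; _+_; _*_; _∸_; _≤_; _<_; z≤n; s≤s; _≤?_; ∣_-_∣; ⌊_/2⌋)
open import Data.Nat.Properties
open import Data.Nat.ListAction using (sum)
open import Data.Nat.ListAction.Properties using (sum-++)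
open import Data.Nat.Induction using (<-wellFounded)
open import Data.Nat.Tactic.RingSolver using (solve-∀)
open import Data.List using (List; []; _∷_; _++_; replicate; length; take; drop; map; lookup)
open import Data.List.Properties
  using (++-assoc; length-++; length-++-≤ʳ; length-replicate; length-take; length-drop; take++drop≡id; ∷-injectiveʳ)
open import Data.List.Membership.Propositional using (_∈_)
open import Data.List.Membership.Propositional.Properties using (∈-∃++; ∈-lookup)
open import Data.List.Relation.Unary.All as All using (All; []; _∷_)
open import Data.List.Relation.Unary.All.Properties as All using ()
open import Data.List.Relation.Unary.AllPairs using (AllPairs; []; _∷_)
open import Data.Fin using (Fin; toℕ) renaming (zero to fzero; suc to fsuc)
open import Data.Product using (_×_; _,_; ∃-syntax; proj₁; proj₂)
open import Data.Unit using (⊤; tt)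
open import Data.Empty using (⊥-elim)
open import Function using (_∘_)
open import Induction.WellFounded using (Acc; acc)
open import Relation.Nullary using (¬_; yes; no)
open import Relation.Binary.PropositionalEquality

-- Statistics of compositions

triangle : ℕ → ℕ
triangle zero    = 0
triangle (suc n) = n + triangle n

triangle-+ : ∀ m n → triangle (m + n) ≡ triangle m + triangle n + m * n
triangle-+ zero    n = sym (+-identityʳ (triangle n))
triangle-+ (suc m) n =
  trans (cong (m + n +_) (triangle-+ m n)) (regroup m n (triangle m) (triangle n))
  where
  regroup : ∀ m n tm tn → m + n + (tm + tn + m * n) ≡ m + tm + tn + (n + m * n)
  regroup = solve-∀

-- For a composition α of n: areaᶜ α and bounceᶜ α are the area and the bounce of
-- p_{n,α}, and slackᶜ α = Σᵢ (αᵢ − 1)(αᵢ₊₁ + ⋯ + α_ℓ) is the largest excess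
-- area π − areaᶜ α of a Dyck path π with bounce composition α.
areaᶜ : List ℕ → ℕ
areaᶜ []      = 0
areaᶜ (a ∷ α) = triangle a + areaᶜ α

bounceᶜ : List ℕ → ℕ
bounceᶜ []      = 0
bounceᶜ (a ∷ α) = sum α + bounceᶜ α

slackᶜ : List ℕ → ℕ
slackᶜ []      = 0
slackᶜ (a ∷ α) = (a ∸ 1) * sum α + slackᶜ α

areaᶜ-++ : ∀ xs ys → areaᶜ (xs ++ ys) ≡ areaᶜ xs + areaᶜ ys
areaᶜ-++ []       ys = refl
areaᶜ-++ (x ∷ xs) ys =
  trans (cong (triangle x +_) (areaᶜ-++ xs ys)) (sym (+-assoc (triangle x) (areaᶜ xs) (areaᶜ ys)))

bounceᶜ-++ : ∀ xs ys → bounceᶜ (xs ++ ys) ≡ bounceᶜ xs + length xs * sum ys + bounceᶜ ys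
bounceᶜ-++ []       ys = refl
bounceᶜ-++ (x ∷ xs) ys rewrite sum-++ xs ys | bounceᶜ-++ xs ys =
  regroup (sum xs) (sum ys) (bounceᶜ xs) (length xs) (bounceᶜ ys)
  where
  regroup : ∀ sx sy bx l by → sx + sy + (bx + l * sy + by) ≡ sx + bx + (sy + l * sy) + by
  regroup = solve-∀

area+bounce+slack≡triangle : ∀ {α} → All (1 ≤_) α →
                             areaᶜ α + bounceᶜ α + slackᶜ α ≡ triangle (sum α)
area+bounce+slack≡triangle {[]}        []       = refl
area+bounce+slack≡triangle {suc c ∷ α} (_ ∷ α⁺) = begin
  triangle (suc c) + areaᶜ α + (s + bounceᶜ α) + (c * s + slackᶜ α)
    ≡⟨ regroup (triangle (suc c)) (areaᶜ α) s (bounceᶜ α) (c * s) (slackᶜ α) ⟩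
  triangle (suc c) + (areaᶜ α + bounceᶜ α + slackᶜ α) + suc c * s
    ≡⟨ cong (λ t → triangle (suc c) + t + suc c * s) (area+bounce+slack≡triangle α⁺) ⟩
  triangle (suc c) + triangle s + suc c * s
    ≡⟨ sym (triangle-+ (suc c) s) ⟩
  triangle (suc c + s) ∎
  where
  open ≡-Reasoning
  s : ℕ
  s = sum α
  regroup : ∀ t a s b cs d → t + a + (s + b) + (cs + d) ≡ t + (a + b + d) + (s + cs)
  regroup = solve-∀

bounceᶜ≤triangle : ∀ {α} → All (1 ≤_) α → bounceᶜ α ≤ triangle (sum α)
bounceᶜ≤triangle {α} α⁺ = begin
  bounceᶜ α                           ≤⟨ m≤n+m (bounceᶜ α) (areaᶜ α) ⟩
  areaᶜ α + bounceᶜ α                 ≤⟨ m≤m+n _ (slackᶜ α) ⟩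
  areaᶜ α + bounceᶜ α + slackᶜ α      ≡⟨ area+bounce+slack≡triangle α⁺ ⟩
  triangle (sum α)                    ∎
  where open ≤-Reasoning

-- Trading slack for bounce

sum-ones : ∀ k → sum (replicate k 1) ≡ k
sum-ones zero    = refl
sum-ones (suc k) = cong suc (sum-ones k)

bounceᶜ-ones : ∀ k → bounceᶜ (replicate k 1) ≡ triangle k
bounceᶜ-ones zero    = refl
bounceᶜ-ones (suc k) = cong₂ _+_ (sum-ones k) (bounceᶜ-ones k)

slackᶜ-ones : ∀ k → slackᶜ (replicate k 1) ≡ 0
slackᶜ-ones zero    = refl
slackᶜ-ones (suc k) = slackᶜ-ones k

slackᶜ-ones-++ : ∀ k ys → slackᶜ (replicate k 1 ++ ys) ≡ slackᶜ ys
slackᶜ-ones-++ zero    ys = refl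
slackᶜ-ones-++ (suc k) ys = slackᶜ-ones-++ k ys

spike : ℕ → ℕ → List ℕ
spike j e = replicate j 1 ++ 2 ∷ replicate e 1

spike-positive : ∀ j e → All (1 ≤_) (spike j e)
spike-positive j e = All.++⁺ (All.replicate⁺ j ≤-refl) (s≤s z≤n ∷ All.replicate⁺ e ≤-refl)

spike-sum : ∀ j e → sum (spike j e) ≡ suc (j + suc e)
spike-sum j e = begin
  sum (replicate j 1 ++ 2 ∷ replicate e 1)         ≡⟨ sum-++ (replicate j 1) _ ⟩
  sum (replicate j 1) + (2 + sum (replicate e 1))  ≡⟨ cong₂ (λ x y → x + (2 + y)) (sum-ones j) (sum-ones e) ⟩
  j + (2 + e)                                      ≡⟨ +-suc j (suc e) ⟩
  suc (j + suc e)                                  ∎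
  where open ≡-Reasoning

spike-slack : ∀ j e → slackᶜ (spike j e) ≡ e
spike-slack j e = begin
  slackᶜ (replicate j 1 ++ 2 ∷ replicate e 1)             ≡⟨ slackᶜ-ones-++ j _ ⟩
  1 * sum (replicate e 1) + slackᶜ (replicate e 1)        ≡⟨ cong₂ _+_ (trans (*-identityˡ _) (sum-ones e)) (slackᶜ-ones e) ⟩
  e + 0                                                   ≡⟨ +-identityʳ e ⟩
  e                                                       ∎
  where open ≡-Reasoning

spike-bounce : ∀ j e → bounceᶜ (spike j e) ≡ j + triangle (j + suc e)
spike-bounce j e
  rewrite bounceᶜ-++ (replicate j 1) (2 ∷ replicate e 1)
        | bounceᶜ-ones j | length-replicate j {1} | sum-ones e | bounceᶜ-ones e
        | triangle-+ j (suc e)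
        = regroup j e (triangle j) (triangle e)
  where
  regroup : ∀ j e tj te → tj + j * (2 + e) + (e + te) ≡ j + (tj + (e + te) + j * (1 + e))
  regroup = solve-∀

-- By bounceᶜ≤triangle, triangle (suc m) bounds the bounce of every composition a ∷ α
-- with sum α ≡ m.  The witness is c′ ∷ spike j e for some c′ ≤ suc c.
large-bounce-with-slack : ∀ c m {d} → d < c * m →
  ∃[ γ ] (IsComposition (suc c + m) γ × slackᶜ γ ≡ d × triangle (suc m) < bounceᶜ γ)
large-bounce-with-slack (suc c) m {d} d<[1+c]m with c * suc m ≤? d
... | no d≱c[1+m]
  with γ , (γ⁺ , sum≡) , slack≡ , bounce> ← large-bounce-with-slack c (suc m) (≰⇒> d≱c[1+m])
  = γ , (γ⁺ , trans sum≡ (cong suc (+-suc c m))) , slack≡ , <-trans (m<n+m _ {suc m} (s≤s z≤n)) bounce>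
... | yes c[1+m]≤d =
  suc c ∷ spike j e ,
  (s≤s z≤n ∷ spike-positive j e , trans (cong (suc c +_) sum-spike) (cong suc (+-suc c m))) ,
  trans (cong₂ _+_ (cong (c *_) sum-spike) (spike-slack j e)) c[1+m]+e≡d ,
  (begin-strict
    m + triangle m                                <⟨ n<1+n _ ⟩
    suc m + triangle m                            ≡⟨ cong (λ l → suc l + triangle l) (sym j+1+e≡m) ⟩
    suc (j + suc e) + triangle (j + suc e)        ≤⟨ +-monoʳ-≤ (suc (j + suc e)) (m≤n+m _ j) ⟩
    suc (j + suc e) + (j + triangle (j + suc e))  ≡⟨ cong₂ _+_ (sym (spike-sum j e)) (sym (spike-bounce j e)) ⟩
    bounceᶜ (suc c ∷ spike j e)                   ∎)
  where
  open ≤-Reasoning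
  e : ℕ
  e = d ∸ c * suc m
  c[1+m]+e≡d : c * suc m + e ≡ d
  c[1+m]+e≡d = m+[n∸m]≡n c[1+m]≤d
  e<m : e < m
  e<m = +-cancelˡ-< (c * m) e m (begin-strict
    c * m + e       ≤⟨ +-monoˡ-≤ e (*-monoʳ-≤ c (n≤1+n m)) ⟩
    c * suc m + e   ≡⟨ c[1+m]+e≡d ⟩
    d               <⟨ d<[1+c]m ⟩
    m + c * m       ≡⟨ +-comm m (c * m) ⟩
    c * m + m       ∎)
  j : ℕ
  j = m ∸ suc e
  j+1+e≡m : j + suc e ≡ m
  j+1+e≡m = m∸n+n≡m e<m
  sum-spike : sum (spike j e) ≡ suc m
  sum-spike = trans (spike-sum j e) (cong suc j+1+e≡m)

smaller-slack-larger-bounce : ∀ {α d} → All (1 ≤_) α → d < slackᶜ α →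
  ∃[ γ ] (IsComposition (sum α) γ × slackᶜ γ ≡ d × bounceᶜ α < bounceᶜ γ)
smaller-slack-larger-bounce {suc c ∷ α} {d} (_ ∷ α⁺) d<slack with c * sum α ≤? d
... | yes cs≤d
  with γ , (γ⁺ , sum≡) , slack≡ , bounce< ← smaller-slack-larger-bounce α⁺ (+-cancelˡ-< (c * sum α) _ _
         (subst (_< c * sum α + slackᶜ α) (sym (m+[n∸m]≡n cs≤d)) d<slack))
  = suc c ∷ γ , (s≤s z≤n ∷ γ⁺ , cong (suc c +_) sum≡) ,
    trans (cong₂ _+_ (cong (c *_) sum≡) slack≡) (m+[n∸m]≡n cs≤d) ,
    +-mono-≤-< (≤-reflexive (sym sum≡)) bounce<
... | no cs≰d
  with γ , γ-comp , slack≡ , bounce> ← large-bounce-with-slack c (sum α) (≰⇒> cs≰d)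
  = γ , γ-comp , slack≡ , ≤-<-trans (+-monoʳ-≤ (sum α) (bounceᶜ≤triangle α⁺)) bounce>

slackᶜ-positive : ∀ {β} → All (1 ≤_) β → areaᶜ β + bounceᶜ β < triangle (sum β) → 0 < slackᶜ β
slackᶜ-positive {β} β⁺ total<triangle = +-cancelˡ-< (areaᶜ β + bounceᶜ β) 0 (slackᶜ β)
  (subst₂ _<_ (sym (+-identityʳ _)) (sym (area+bounce+slack≡triangle β⁺)) total<triangle)

-- areaᶜ + bounceᶜ + slackᶜ is constant, so lowering the slack by one while raising
-- the bounce cannot raise the area.
area+bounce-step : ∀ {n β} → IsComposition n β → areaᶜ β + bounceᶜ β < triangle n →
  ∃[ γ ] (IsComposition n γ × areaᶜ γ + bounceᶜ γ ≡ suc (areaᶜ β + bounceᶜ β) × areaᶜ γ ≤ areaᶜ β)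
area+bounce-step {β = β} (β⁺ , refl) total<triangle
  with γ , γ-comp@(γ⁺ , sum≡) , slack≡ , bounce< ←
         smaller-slack-larger-bounce β⁺ (≤-reflexive (m+[n∸m]≡n (slackᶜ-positive β⁺ total<triangle)))
  = γ , γ-comp , total≡ , area≤
  where
  total : ℕ
  total = areaᶜ β + bounceᶜ β
  total≡ : areaᶜ γ + bounceᶜ γ ≡ suc total
  total≡ = +-cancelʳ-≡ (slackᶜ β ∸ 1) _ _ (begin
    areaᶜ γ + bounceᶜ γ + (slackᶜ β ∸ 1)    ≡⟨ cong (areaᶜ γ + bounceᶜ γ +_) (sym slack≡) ⟩
    areaᶜ γ + bounceᶜ γ + slackᶜ γ          ≡⟨ area+bounce+slack≡triangle γ⁺ ⟩
    triangle (sum γ)                        ≡⟨ cong triangle sum≡ ⟩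
    triangle (sum β)                        ≡⟨ sym (area+bounce+slack≡triangle β⁺) ⟩
    total + slackᶜ β                        ≡⟨ cong (total +_) (sym (m+[n∸m]≡n (slackᶜ-positive β⁺ total<triangle))) ⟩
    total + suc (slackᶜ β ∸ 1)              ≡⟨ +-suc total _ ⟩
    suc total + (slackᶜ β ∸ 1)              ∎)
    where open ≡-Reasoning
  area≤ : areaᶜ γ ≤ areaᶜ β
  area≤ = +-cancelʳ-≤ (bounceᶜ γ) _ _ (begin
    areaᶜ γ + bounceᶜ γ         ≡⟨ total≡ ⟩
    suc total                   ≡⟨ sym (+-suc (areaᶜ β) (bounceᶜ β)) ⟩
    areaᶜ β + suc (bounceᶜ β)   ≤⟨ +-monoʳ-≤ (areaᶜ β) bounce< ⟩
    areaᶜ β + bounceᶜ γ         ∎)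
    where open ≤-Reasoning

raise-area+bounce : ∀ {n β} k → IsComposition n β → areaᶜ β + bounceᶜ β + k ≤ triangle n →
  ∃[ γ ] (IsComposition n γ × areaᶜ γ + bounceᶜ γ ≡ areaᶜ β + bounceᶜ β + k × areaᶜ γ ≤ areaᶜ β)
raise-area+bounce {β = β} zero β-comp _ = β , β-comp , sym (+-identityʳ _) , ≤-refl
raise-area+bounce {n} {β} (suc k) β-comp ≤triangle
  with γ₁ , γ₁-comp , total₁≡ , area₁≤ ← area+bounce-step β-comp (<-≤-trans (m<m+n _ (s≤s z≤n)) ≤triangle)
  with γ , γ-comp , total≡ , area≤ ← raise-area+bounce k γ₁-comp
         (subst (λ t → t + k ≤ triangle n) (sym total₁≡) (≤-trans (≤-reflexive (sym (+-suc _ k))) ≤triangle))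
  = γ , γ-comp , trans total≡ (trans (cong (_+ k) total₁≡) (sym (+-suc _ k))) , ≤-trans area≤ area₁≤

-- Local moves

record _Improves_ (β α : List ℕ) : Set where
  field
    positive     : All (1 ≤_) β
    sum≡         : sum β ≡ sum α
    area+bounce≤ : areaᶜ β + bounceᶜ β ≤ areaᶜ α + bounceᶜ α
    area<        : areaᶜ β < areaᶜ α

AreaMinimal : List ℕ → Set
AreaMinimal α = ∀ β → ¬ (β Improves α)

∷-improves : ∀ {x α β} → 1 ≤ x → β Improves α → (x ∷ β) Improves (x ∷ α)
∷-improves {x} {α} {β} 1≤x β≻α = record
  { positive     = 1≤x ∷ positive
  ; sum≡         = cong (x +_) sum≡
  ; area+bounce≤ = begin
      triangle x + areaᶜ β + (sum β + bounceᶜ β)     ≡⟨ cong (λ s → triangle x + areaᶜ β + (s + bounceᶜ β)) sum≡ ⟩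
      triangle x + areaᶜ β + (sum α + bounceᶜ β)     ≡⟨ regroup (triangle x) (areaᶜ β) (sum α) (bounceᶜ β) ⟩
      triangle x + sum α + (areaᶜ β + bounceᶜ β)     ≤⟨ +-monoʳ-≤ (triangle x + sum α) area+bounce≤ ⟩
      triangle x + sum α + (areaᶜ α + bounceᶜ α)     ≡⟨ sym (regroup (triangle x) (areaᶜ α) (sum α) (bounceᶜ α)) ⟩
      triangle x + areaᶜ α + (sum α + bounceᶜ α)     ∎
  ; area<        = +-monoʳ-< (triangle x) area<
  }
  where
  open _Improves_ β≻α
  open ≤-Reasoning
  regroup : ∀ t a s b → t + a + (s + b) ≡ t + s + (a + b)
  regroup = solve-∀

AreaMinimal-∷⁻ : ∀ {x α} → 1 ≤ x → AreaMinimal (x ∷ α) → AreaMinimal α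
AreaMinimal-∷⁻ 1≤x minimal β β≻α = minimal _ (∷-improves 1≤x β≻α)

raise-improves : ∀ {a b} ys zs → a < b → All (1 ≤_) ys → All (1 ≤_) zs →
                 (suc a ∷ ys ++ b ∷ zs) Improves (a ∷ ys ++ suc b ∷ zs)
raise-improves {a} {b} ys zs a<b ys⁺ zs⁺ = record
  { positive     = s≤s z≤n ∷ All.++⁺ ys⁺ (≤-trans (s≤s z≤n) a<b ∷ zs⁺)
  ; sum≡         = sum≡
  ; area+bounce≤ = +-mono-≤ (<⇒≤ area<) bounce≤
  ; area<        = area<
  }
  where
  β : List ℕ
  β = suc a ∷ ys ++ b ∷ zs
  α : List ℕ
  α = a ∷ ys ++ suc b ∷ zs
  sum≡ : sum β ≡ sum α
  sum≡ rewrite sum-++ ys (b ∷ zs) | sum-++ ys (suc b ∷ zs) = shift a b (sum ys) (sum zs)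
    where
    shift : ∀ a b y z → suc a + (y + (b + z)) ≡ a + (y + (suc b + z))
    shift = solve-∀
  area≡ : areaᶜ β + b ≡ areaᶜ α + a
  area≡ rewrite areaᶜ-++ ys (b ∷ zs) | areaᶜ-++ ys (suc b ∷ zs) =
    shift a b (triangle a) (triangle b) (areaᶜ ys) (areaᶜ zs)
    where
    shift : ∀ a b ta tb y z → a + ta + (y + (tb + z)) + b ≡ ta + (y + (b + tb + z)) + a
    shift = solve-∀
  area< : areaᶜ β < areaᶜ α
  area< = +-cancelʳ-< b _ _ (subst (_< areaᶜ α + b) (sym area≡) (+-monoʳ-< (areaᶜ α) a<b))
  bounce≡ : bounceᶜ α ≡ suc (length ys) + bounceᶜ β
  bounce≡ rewrite sum-++ ys (b ∷ zs) | sum-++ ys (suc b ∷ zs)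
                | bounceᶜ-++ ys (b ∷ zs) | bounceᶜ-++ ys (suc b ∷ zs) =
    shift b (sum ys) (sum zs) (bounceᶜ ys) (length ys) (bounceᶜ zs)
    where
    shift : ∀ b y z by l bz → y + (suc b + z) + (by + l * (suc b + z) + (z + bz))
                             ≡ suc (l + (y + (b + z) + (by + l * (b + z) + (z + bz))))
    shift = solve-∀
  bounce≤ : bounceᶜ β ≤ bounceᶜ α
  bounce≤ = ≤-trans (m≤n+m _ (suc (length ys))) (≤-reflexive (sym bounce≡))

balance-improves : ∀ {a b} zs → b < a → All (1 ≤_) zs → (a ∷ suc b ∷ zs) Improves (suc a ∷ b ∷ zs)
balance-improves {a} {b} zs b<a zs⁺ = record
  { positive     = ≤-trans (s≤s z≤n) b<a ∷ s≤s z≤n ∷ zs⁺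
  ; sum≡         = +-suc a (b + sum zs)
  ; area+bounce≤ = ≤-trans (≤-reflexive (+-suc (areaᶜ β) (bounceᶜ α))) (+-monoˡ-≤ (bounceᶜ α) area<)
  ; area<        = area<
  }
  where
  β : List ℕ
  β = a ∷ suc b ∷ zs
  α : List ℕ
  α = suc a ∷ b ∷ zs
  area≡ : areaᶜ β + a ≡ areaᶜ α + b
  area≡ = shift a b (triangle a) (triangle b) (areaᶜ zs)
    where
    shift : ∀ a b ta tb z → ta + (b + tb + z) + a ≡ a + ta + (tb + z) + b
    shift = solve-∀
  area< : areaᶜ β < areaᶜ α
  area< = +-cancelʳ-< a _ _ (subst (_< areaᶜ α + a) (sym area≡) (+-monoʳ-< (areaᶜ α) b<a))

split-last-improves : ∀ {a} → 1 ≤ a → (a ∷ 1 ∷ []) Improves (suc a ∷ [])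
split-last-improves {a} 1≤a = record
  { positive     = 1≤a ∷ ≤-refl ∷ []
  ; sum≡         = +-suc a 0
  ; area+bounce≤ = subst₂ _≤_ (+-comm 1 _) (sym (+-identityʳ _)) area<
  ; area<        = area<
  }
  where
  area< : areaᶜ (a ∷ 1 ∷ []) < areaᶜ (suc a ∷ [])
  area< = subst₂ _≤_ (sym (cong suc (+-identityʳ _))) (sym (+-identityʳ _)) (+-monoˡ-≤ (triangle a) 1≤a)

-- Any occurrence of b after a will do, which is why membership suffices.
no-jump-from-head : ∀ {a b α} → All (1 ≤_) (a ∷ α) → AreaMinimal (a ∷ α) → b ∈ α → ¬ (suc a < b)
no-jump-from-head {b = suc b} (_ ∷ α⁺) minimal b∈α (s≤s a<b)
  with ys , zs , refl ← ∈-∃++ b∈α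
  with ys⁺ , _ ∷ zs⁺ ← All.++⁻ ys α⁺
  = minimal _ (raise-improves ys zs a<b ys⁺ zs⁺)

AreaMinimal⇒no-jump : ∀ {α} → All (1 ≤_) α → AreaMinimal α → (i k : Fin (length α)) →
                      toℕ i < toℕ k → ¬ (suc (lookup α i) < lookup α k)
AreaMinimal⇒no-jump {_ ∷ _} α⁺ minimal fzero (fsuc k) _ = no-jump-from-head α⁺ minimal (∈-lookup k)
AreaMinimal⇒no-jump {_ ∷ _} (1≤x ∷ α⁺) minimal (fsuc i) (fsuc k) (s≤s i<k) =
  AreaMinimal⇒no-jump α⁺ (AreaMinimal-∷⁻ 1≤x minimal) i k i<k

AreaMinimal⇒no-drop : ∀ {α} → All (1 ≤_) α → AreaMinimal α → (i j : Fin (length α)) →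
                      toℕ j ≡ suc (toℕ i) → ¬ (suc (lookup α j) < lookup α i)
AreaMinimal⇒no-drop {suc a ∷ b ∷ zs} (_ ∷ _ ∷ zs⁺) minimal fzero (fsuc fzero) _ (s≤s b<a) =
  minimal _ (balance-improves zs b<a zs⁺)
AreaMinimal⇒no-drop {_ ∷ _} (1≤x ∷ α⁺) minimal (fsuc i) (fsuc j) j≡1+i =
  AreaMinimal⇒no-drop α⁺ (AreaMinimal-∷⁻ 1≤x minimal) i j (suc-injective j≡1+i)

∣-∣≤1 : ∀ {a b} → b ≤ suc a → a ≤ suc b → ∣ a - b ∣ ≤ 1
∣-∣≤1 {zero}  {b}     b≤1 _   = b≤1
∣-∣≤1 {suc a} {zero}  _   a≤1 = a≤1
∣-∣≤1 {suc a} {suc b} (s≤s b≤1+a) (s≤s a≤1+b) = ∣-∣≤1 b≤1+a a≤1+b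

AreaMinimal⇒adjacent-close : ∀ {α} → All (1 ≤_) α → AreaMinimal α → (i j : Fin (length α)) →
                             toℕ j ≡ suc (toℕ i) → ∣ lookup α i - lookup α j ∣ ≤ 1
AreaMinimal⇒adjacent-close α⁺ minimal i j j≡1+i = ∣-∣≤1
  (≮⇒≥ (AreaMinimal⇒no-jump α⁺ minimal i j (≤-reflexive (sym j≡1+i))))
  (≮⇒≥ (AreaMinimal⇒no-drop α⁺ minimal i j j≡1+i))

AreaMinimal⇒last≡1 : ∀ {α} → All (1 ≤_) α → AreaMinimal α → (i : Fin (length α)) →
                     suc (toℕ i) ≡ length α → lookup α i ≡ 1
AreaMinimal⇒last≡1 {suc zero ∷ []}      _           _       fzero _ = refl
AreaMinimal⇒last≡1 {suc (suc a) ∷ []}   _           minimal fzero _ =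
  ⊥-elim (minimal _ (split-last-improves (s≤s z≤n)))
AreaMinimal⇒last≡1 {_ ∷ _ ∷ _}          _           _       fzero ()
AreaMinimal⇒last≡1 {_ ∷ _}              (1≤x ∷ α⁺) minimal (fsuc i) 2+i≡len =
  AreaMinimal⇒last≡1 α⁺ (AreaMinimal-∷⁻ 1≤x minimal) i (suc-injective 2+i≡len)

AreaMinimal⇒no-increasing-triple : ∀ {α} → All (1 ≤_) α → AreaMinimal α →
  ¬ (∃[ i ] ∃[ j ] ∃[ k ] (toℕ i < toℕ j × toℕ j < toℕ k × lookup α i < lookup α j × lookup α j < lookup α k))
AreaMinimal⇒no-increasing-triple α⁺ minimal (i , j , k , i<j , j<k , αi<αj , αj<αk) =
  AreaMinimal⇒no-jump α⁺ minimal i k (<-trans i<j j<k) (<-≤-trans (s≤s αi<αj) αj<αk)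

-- Heights and bounce blocks of Dyck paths

northSteps : List Step → ℕ
northSteps []      = 0
northSteps (N ∷ s) = suc (northSteps s)
northSteps (E ∷ s) = northSteps s

length≡northSteps+length-heightsFrom : ∀ y s → length s ≡ northSteps s + length (heightsFrom y s)
length≡northSteps+length-heightsFrom y []      = refl
length≡northSteps+length-heightsFrom y (N ∷ s) = cong suc (length≡northSteps+length-heightsFrom (suc y) s)
length≡northSteps+length-heightsFrom y (E ∷ s) =
  trans (cong suc (length≡northSteps+length-heightsFrom y s)) (sym (+-suc _ _))

length-heightsFrom : ∀ {k y} s → Ballot k s → length (heightsFrom y s) ≡ k + northSteps s
length-heightsFrom         []      refl = refl
length-heightsFrom {k}     (N ∷ s) b    = trans (length-heightsFrom s b) (sym (+-suc k _))
length-heightsFrom {suc k} (E ∷ s) b    = cong suc (length-heightsFrom s b)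

heightsFrom-≤ : ∀ y s → All (_≤ y + northSteps s) (heightsFrom y s)
heightsFrom-≤ y []      = []
heightsFrom-≤ y (N ∷ s) = All.map (λ h≤ → ≤-trans h≤ (≤-reflexive (sym (+-suc y _)))) (heightsFrom-≤ (suc y) s)
heightsFrom-≤ y (E ∷ s) = m≤m+n y _ ∷ heightsFrom-≤ y s

heightsFrom-≥ : ∀ y s → All (y ≤_) (heightsFrom y s)
heightsFrom-≥ y []      = []
heightsFrom-≥ y (N ∷ s) = All.map (≤-trans (n≤1+n y)) (heightsFrom-≥ (suc y) s)
heightsFrom-≥ y (E ∷ s) = ≤-refl ∷ heightsFrom-≥ y s

heightsFrom-sorted : ∀ y s → AllPairs _≤_ (heightsFrom y s)
heightsFrom-sorted y []      = []
heightsFrom-sorted y (N ∷ s) = heightsFrom-sorted (suc y) s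
heightsFrom-sorted y (E ∷ s) = heightsFrom-≥ y s ∷ heightsFrom-sorted y s

-- hs are the heights of the east steps in columns p + 1, p + 2, …
AboveDiagonal : ℕ → List ℕ → Set
AboveDiagonal p []       = ⊤
AboveDiagonal p (h ∷ hs) = p < h × AboveDiagonal (suc p) hs

AboveDiagonal-drop : ∀ {q} k hs → AboveDiagonal q hs → AboveDiagonal (q + k) (drop k hs)
AboveDiagonal-drop {q} zero    hs       above = subst (λ r → AboveDiagonal r hs) (sym (+-identityʳ q)) above
AboveDiagonal-drop     (suc k) []       _     = tt
AboveDiagonal-drop {q} (suc k) (h ∷ hs) (_ , above) =
  subst (λ r → AboveDiagonal r (drop k hs)) (sym (+-suc q k)) (AboveDiagonal-drop k hs above)

heightsFrom-above : ∀ {k x} s → Ballot k s → AboveDiagonal x (heightsFrom (k + x) s)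
heightsFrom-above             []      _ = tt
heightsFrom-above             (N ∷ s) b = heightsFrom-above s b
heightsFrom-above {suc k} {x} (E ∷ s) b =
  s≤s (m≤n+m x k) , subst (λ y → AboveDiagonal (suc x) (heightsFrom y s)) (+-suc k x) (heightsFrom-above s b)

dyck-northSteps : ∀ {n π} → IsDyck n π → northSteps π ≡ n
dyck-northSteps {n} {π} (length≡ , ballot) =
  trans (n≡⌊n+n/2⌋ _) (trans (cong ⌊_/2⌋ N+N≡n+n) (sym (n≡⌊n+n/2⌋ n)))
  where
  N+N≡n+n : northSteps π + northSteps π ≡ n + n
  N+N≡n+n = trans (cong (northSteps π +_) (sym (length-heightsFrom {y = 0} π ballot)))
                  (trans (sym (length≡northSteps+length-heightsFrom 0 π)) length≡)

dyck-length-heights : ∀ {n π} → IsDyck n π → length (heights π) ≡ n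
dyck-length-heights {π = π} dyck = trans (length-heightsFrom π (proj₂ dyck)) (dyck-northSteps {π = π} dyck)

dyck-heights≤ : ∀ {n π} → IsDyck n π → All (_≤ n) (heights π)
dyck-heights≤ {π = π} dyck = subst (λ m → All (_≤ m) (heights π)) (dyck-northSteps {π = π} dyck) (heightsFrom-≤ 0 π)

-- Blocks p hs α: the heights hs of columns p + 1, p + 2, … split into consecutive
-- bounce blocks of sizes α; a block of size 1 + a starting after column p opens
-- with the height p + 1 + a, which is its bounce point.
data Blocks : ℕ → List ℕ → List ℕ → Set where
  []    : ∀ {p} → Blocks p [] []
  block : ∀ {p a rest α} (bl : List ℕ) → length bl ≡ a → Blocks (p + suc a) rest α →
          Blocks p (p + suc a ∷ bl ++ rest) (suc a ∷ α)

blocks-sum : ∀ {p hs α} → Blocks p hs α → length hs ≡ sum α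
blocks-sum []                = refl
blocks-sum (block bl refl b) = cong suc (trans (length-++ bl) (cong (length bl +_) (blocks-sum b)))

blocks-positive : ∀ {p hs α} → Blocks p hs α → All (1 ≤_) α
blocks-positive []               = []
blocks-positive (block _ refl b) = s≤s z≤n ∷ blocks-positive b

block-decomposition : ∀ {n p} hs → Acc _<_ (length hs) → AboveDiagonal p hs → All (_≤ n) hs →
         p + length hs ≡ n → ∃[ α ] Blocks p hs α
block-decomposition []       _        _ _ _ = [] , []
block-decomposition {n} {p} (h ∷ hs) (acc rs) (p<h , above) (h≤n ∷ hs≤n) p+len≡n =
  suc a ∷ α , subst₂ (λ x xs → Blocks p (x ∷ xs) (suc a ∷ α)) p+1+a≡h (take++drop≡id a hs)
                     (block (take a hs) length-take≡a rest-blocks)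
  where
  a : ℕ
  a = h ∸ suc p
  p+1+a≡h : p + suc a ≡ h
  p+1+a≡h = trans (+-suc p a) (m+[n∸m]≡n p<h)
  a≤len : a ≤ length hs
  a≤len = +-cancelˡ-≤ (suc p) a (length hs) (begin
    suc p + a           ≡⟨ m+[n∸m]≡n p<h ⟩
    h                   ≤⟨ h≤n ⟩
    n                   ≡⟨ sym p+len≡n ⟩
    p + suc (length hs) ≡⟨ +-suc p _ ⟩
    suc p + length hs   ∎)
    where open ≤-Reasoning
  length-take≡a : length (take a hs) ≡ a
  length-take≡a = trans (length-take a hs) (m≤n⇒m⊓n≡m a≤len)
  rest-length : p + suc a + length (drop a hs) ≡ n
  rest-length = begin
    p + suc a + length (drop a hs)   ≡⟨ cong (p + suc a +_) (length-drop a hs) ⟩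
    p + suc a + (length hs ∸ a)      ≡⟨ +-assoc p (suc a) _ ⟩
    p + suc (a + (length hs ∸ a))    ≡⟨ cong (λ l → p + suc l) (m+[n∸m]≡n a≤len) ⟩
    p + suc (length hs)              ≡⟨ p+len≡n ⟩
    n                                ∎
    where open ≡-Reasoning
  rest-above : AboveDiagonal (p + suc a) (drop a hs)
  rest-above = subst (λ r → AboveDiagonal r (drop a hs)) (sym (+-suc p a)) (AboveDiagonal-drop a hs above)
  rest : ∃[ α ] Blocks (p + suc a) (drop a hs) α
  rest = block-decomposition (drop a hs) (rs (s≤s (≤-trans (≤-reflexive (length-drop a hs)) (m∸n≤m _ a))))
                rest-above (All.drop⁺ a hs≤n) rest-length
  α : List ℕ
  α = proj₁ rest
  rest-blocks : Blocks (p + suc a) (drop a hs) α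
  rest-blocks = proj₂ rest

partialSums : ℕ → List ℕ → List ℕ
partialSums p []      = []
partialSums p (a ∷ α) = p + a ∷ partialSums (p + a) α

at-++ : ∀ (xs : List ℕ) {y ys} → at (xs ++ y ∷ ys) (length xs) ≡ y
at-++ []       = refl
at-++ (x ∷ xs) = at-++ xs

bouncePtsGo-blocks : ∀ {n p hs α} fuel pre → Blocks p hs α → length pre ≡ p → p + length hs ≡ n →
                     length hs ≤ fuel → bouncePtsGo n (pre ++ hs) fuel p ≡ partialSums p α
bouncePtsGo-blocks zero pre [] _ _ _ = refl
bouncePtsGo-blocks {n} {p} (suc fuel) pre [] _ p+0≡n _ with p ≟ n
... | yes _   = refl
... | no  p≢n = ⊥-elim (p≢n (trans (sym (+-identityʳ p)) p+0≡n))
bouncePtsGo-blocks {n} (suc fuel) pre (block {rest = rest} bl refl b) refl p+len≡n (s≤s len≤fuel)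
  with length pre ≟ n
... | yes p≡n = ⊥-elim (m+1+n≢m (length pre) (trans p+len≡n (sym p≡n)))
... | no  _ rewrite at-++ pre {length pre + suc (length bl)} {bl ++ rest} = cong (x ∷_) (begin
    bouncePtsGo n (pre ++ x ∷ bl ++ rest) fuel x     ≡⟨ cong (λ H → bouncePtsGo n H fuel x) (sym (++-assoc pre (x ∷ bl) rest)) ⟩
    bouncePtsGo n ((pre ++ x ∷ bl) ++ rest) fuel x   ≡⟨ bouncePtsGo-blocks fuel (pre ++ x ∷ bl) b (length-++ pre) x+len≡n
                                                          (≤-trans (length-++-≤ʳ rest {bl}) len≤fuel) ⟩
    partialSums x _                                  ∎)
  where
  open ≡-Reasoning
  x : ℕ
  x = length pre + suc (length bl)
  x+len≡n : x + length rest ≡ n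
  x+len≡n = trans (+-assoc (length pre) _ _) (trans (cong (λ l → length pre + suc l) (sym (length-++ bl))) p+len≡n)

diffs-partialSums : ∀ p α → diffs p (partialSums p α) ≡ α
diffs-partialSums p []      = refl
diffs-partialSums p (a ∷ α) = cong₂ _∷_ (m+n∸m≡n p a) (diffs-partialSums (p + a) α)

sum-map-∸-partialSums : ∀ {n} p α → p + sum α ≡ n → sum (map (n ∸_) (partialSums p α)) ≡ bounceᶜ α
sum-map-∸-partialSums p []      _  = refl
sum-map-∸-partialSums {n} p (a ∷ α) p+a+s≡n = cong₂ _+_
  (trans (cong (_∸ (p + a)) (sym p+a+s≡n′)) (m+n∸m≡n (p + a) (sum α)))
  (sum-map-∸-partialSums (p + a) α p+a+s≡n′)
  where
  p+a+s≡n′ : p + a + sum α ≡ n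
  p+a+s≡n′ = trans (+-assoc p a (sum α)) p+a+s≡n

bouncePoints-blocks : ∀ {n π α} → Blocks 0 (heights π) α → sum α ≡ n → bouncePoints n π ≡ partialSums 0 α
bouncePoints-blocks {n} {π} b sum≡n =
  bouncePtsGo-blocks _ [] b refl length≡n (≤-reflexive length≡n)
  where
  length≡n : length (heights π) ≡ n
  length≡n = trans (blocks-sum b) sum≡n

bounce-blocks : ∀ {n π α} → Blocks 0 (heights π) α → sum α ≡ n → bounce n π ≡ bounceᶜ α
bounce-blocks {n} {π} {α} b sum≡n =
  trans (cong (sum ∘ map (n ∸_)) (bouncePoints-blocks {π = π} b sum≡n)) (sum-map-∸-partialSums 0 α sum≡n)

dyck-blocks : ∀ {n π} → IsDyck n π → Blocks 0 (heights π) (bounceComp n π)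
dyck-blocks {n} {π} dyck@(_ , ballot) =
  subst (Blocks 0 (heights π)) (sym bounceComp≡α) (proj₂ α-blocks)
  where
  length≡n : length (heights π) ≡ n
  length≡n = dyck-length-heights {n} {π} dyck
  α-blocks : ∃[ α ] Blocks 0 (heights π) α
  α-blocks = block-decomposition (heights π) (<-wellFounded _) (heightsFrom-above π ballot)
                    (dyck-heights≤ {n} {π} dyck) length≡n
  bounceComp≡α : bounceComp n π ≡ proj₁ α-blocks
  bounceComp≡α = trans
    (cong (diffs 0) (bouncePoints-blocks {π = π} (proj₂ α-blocks) (trans (sym (blocks-sum (proj₂ α-blocks))) length≡n)))
    (diffs-partialSums 0 _)

bounceComp-composition : ∀ {n π} → IsDyck n π → IsComposition n (bounceComp n π)
bounceComp-composition {n} {π} dyck =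
  blocks-positive (dyck-blocks {n} {π} dyck) ,
  trans (sym (blocks-sum (dyck-blocks {n} {π} dyck))) (dyck-length-heights {n} {π} dyck)

bounce≡bounceᶜ : ∀ {n π} → IsDyck n π → bounce n π ≡ bounceᶜ (bounceComp n π)
bounce≡bounceᶜ {n} {π} dyck =
  bounce-blocks {π = π} (dyck-blocks {n} {π} dyck) (proj₂ (bounceComp-composition {n} {π} dyck))

-- Area

areaFrom-++ : ∀ i xs ys → areaFrom i (xs ++ ys) ≡ areaFrom i xs + areaFrom (i + length xs) ys
areaFrom-++ i []       ys = cong (λ j → areaFrom j ys) (sym (+-identityʳ i))
areaFrom-++ i (x ∷ xs) ys = begin
  x ∸ suc i + areaFrom (suc i) (xs ++ ys)
    ≡⟨ cong (x ∸ suc i +_) (areaFrom-++ (suc i) xs ys) ⟩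
  x ∸ suc i + (areaFrom (suc i) xs + areaFrom (suc i + length xs) ys)
    ≡⟨ sym (+-assoc (x ∸ suc i) _ _) ⟩
  x ∸ suc i + areaFrom (suc i) xs + areaFrom (suc i + length xs) ys
    ≡⟨ cong (λ j → x ∸ suc i + areaFrom (suc i) xs + areaFrom j ys) (sym (+-suc i (length xs))) ⟩
  x ∸ suc i + areaFrom (suc i) xs + areaFrom (i + suc (length xs)) ys ∎
  where open ≡-Reasoning

m+[1+n]∸[1+m]≡n : ∀ m n → m + suc n ∸ suc m ≡ n
m+[1+n]∸[1+m]≡n m n = trans (cong (_∸ suc m) (+-suc m n)) (m+n∸m≡n m n)

m+[1+n]≤o⇒n≤o∸[1+m] : ∀ {m n o} → m + suc n ≤ o → n ≤ o ∸ suc m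
m+[1+n]≤o⇒n≤o∸[1+m] {m} {n} m+1+n≤o = ≤-trans (≤-reflexive (sym (m+[1+n]∸[1+m]≡n m n))) (∸-monoˡ-≤ (suc m) m+1+n≤o)

+-≡-squeeze : ∀ {x y u v} → u ≤ x → v ≤ y → x + y ≡ u + v → x ≡ u × y ≡ v
+-≡-squeeze {x} {y} {u} {v} u≤x v≤y x+y≡u+v = x≡u , +-cancelˡ-≡ u y v (trans (cong (_+ y) (sym x≡u)) x+y≡u+v)
  where
  x≡u : x ≡ u
  x≡u = ≤-antisym (+-cancelʳ-≤ y x u (≤-trans (≤-reflexive x+y≡u+v) (+-monoʳ-≤ u v≤y))) u≤x

areaFrom-replicate : ∀ q a → areaFrom q (replicate a (q + a)) ≡ triangle a
areaFrom-replicate q zero    = refl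
areaFrom-replicate q (suc a) = cong₂ _+_ (m+[1+n]∸[1+m]≡n q a)
  (trans (cong (λ h → areaFrom (suc q) (replicate a h)) (+-suc q a)) (areaFrom-replicate (suc q) a))

triangle≤areaFrom : ∀ q xs → All (q + length xs ≤_) xs → triangle (length xs) ≤ areaFrom q xs
triangle≤areaFrom q []       _ = z≤n
triangle≤areaFrom q (x ∷ xs) (q+1+l≤x ∷ floor) =
  +-mono-≤ (m+[1+n]≤o⇒n≤o∸[1+m] q+1+l≤x)
           (triangle≤areaFrom (suc q) xs (All.map (≤-trans (≤-reflexive (sym (+-suc q _)))) floor))

areaFrom≡triangle⇒replicate : ∀ q xs → All (q + length xs ≤_) xs → areaFrom q xs ≡ triangle (length xs) →
                              xs ≡ replicate (length xs) (q + length xs)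
areaFrom≡triangle⇒replicate q []       _ _ = refl
areaFrom≡triangle⇒replicate q (x ∷ xs) (q+1+l≤x ∷ floor) area≡ =
  cong₂ _∷_ x≡ (trans xs≡ (cong (replicate l) (sym (+-suc q l))))
  where
  l : ℕ
  l = length xs
  floor′ : All (suc q + l ≤_) xs
  floor′ = All.map (≤-trans (≤-reflexive (sym (+-suc q l)))) floor
  parts : x ∸ suc q ≡ l × areaFrom (suc q) xs ≡ triangle l
  parts = +-≡-squeeze (m+[1+n]≤o⇒n≤o∸[1+m] q+1+l≤x) (triangle≤areaFrom (suc q) xs floor′) area≡
  x≡ : x ≡ q + suc l
  x≡ = begin
    x                    ≡⟨ sym (m+[n∸m]≡n (≤-trans (s≤s (m≤m+n q l)) (≤-trans (≤-reflexive (sym (+-suc q l))) q+1+l≤x))) ⟩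
    suc q + (x ∸ suc q)  ≡⟨ cong (suc q +_) (proj₁ parts) ⟩
    suc q + l            ≡⟨ sym (+-suc q l) ⟩
    q + suc l            ∎
    where open ≡-Reasoning
  xs≡ : xs ≡ replicate l (suc q + l)
  xs≡ = areaFrom≡triangle⇒replicate (suc q) xs floor′ (proj₂ parts)

areaFrom≤ : ∀ n q xs → All (_≤ n) xs → q + length xs ≤ n →
            areaFrom q xs ≤ triangle (length xs) + length xs * (n ∸ (q + length xs))
areaFrom≤ n q []       _            _        = z≤n
areaFrom≤ n q (x ∷ xs) (x≤n ∷ xs≤n) q+1+l≤n = begin
  x ∸ suc q + areaFrom (suc q) xs
    ≤⟨ +-mono-≤ (∸-monoˡ-≤ (suc q) x≤n) (areaFrom≤ n (suc q) xs xs≤n 1+q+l≤n) ⟩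
  n ∸ suc q + (triangle l + l * r)
    ≡⟨ cong (_+ (triangle l + l * r)) (trans (sym (m+[n∸m]≡n l≤n∸[1+q])) (cong (l +_) (∸-+-assoc n (suc q) l))) ⟩
  l + r + (triangle l + l * r)
    ≡⟨ regroup l r (triangle l) ⟩
  l + triangle l + suc l * r
    ≡⟨ cong (λ m → l + triangle l + suc l * (n ∸ m)) (sym (+-suc q l)) ⟩
  triangle (suc l) + suc l * (n ∸ (q + suc l)) ∎
  where
  open ≤-Reasoning
  l : ℕ
  l = length xs
  1+q+l≤n : suc q + l ≤ n
  1+q+l≤n = ≤-trans (≤-reflexive (sym (+-suc q l))) q+1+l≤n
  r : ℕ
  r = n ∸ (suc q + l)
  l≤n∸[1+q] : l ≤ n ∸ suc q
  l≤n∸[1+q] = m+[1+n]≤o⇒n≤o∸[1+m] q+1+l≤n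
  regroup : ∀ l r t → l + r + (t + l * r) ≡ l + t + (r + l * r)
  regroup = solve-∀

areaFrom-block : ∀ p bl rest → areaFrom p (p + suc (length bl) ∷ bl ++ rest) ≡
                 length bl + areaFrom (suc p) bl + areaFrom (p + suc (length bl)) rest
areaFrom-block p bl rest = trans
  (cong₂ _+_ (m+[1+n]∸[1+m]≡n p _)
             (trans (areaFrom-++ (suc p) bl rest) (cong (λ j → areaFrom (suc p) bl + areaFrom j rest) (sym (+-suc p _)))))
  (sym (+-assoc (length bl) _ _))

block-floor : ∀ p bl {rest} → All (p + suc (length bl) ≤_) (bl ++ rest) → All (suc p + length bl ≤_) bl
block-floor p bl = All.map (≤-trans (≤-reflexive (sym (+-suc p _)))) ∘ All.++⁻ˡ bl

sorted-++⁻ʳ : ∀ xs {ys} → AllPairs _≤_ (xs ++ ys) → AllPairs _≤_ ys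
sorted-++⁻ʳ []       sorted       = sorted
sorted-++⁻ʳ (x ∷ xs) (_ ∷ sorted) = sorted-++⁻ʳ xs sorted

areaᶜ≤areaFrom : ∀ {p hs α} → Blocks p hs α → AllPairs _≤_ hs → areaᶜ α ≤ areaFrom p hs
areaᶜ≤areaFrom []                                      _             = z≤n
areaᶜ≤areaFrom {p} (block {rest = rest} {α} bl refl b) (x≤ ∷ sorted) = begin
  l + triangle l + areaᶜ α
    ≡⟨ +-assoc l (triangle l) (areaᶜ α) ⟩
  l + (triangle l + areaᶜ α)
    ≤⟨ +-monoʳ-≤ l (+-mono-≤ (triangle≤areaFrom (suc p) bl (block-floor p bl x≤))
                             (areaᶜ≤areaFrom b (sorted-++⁻ʳ bl sorted))) ⟩
  l + (areaFrom (suc p) bl + areaFrom (p + suc l) rest)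
    ≡⟨ sym (+-assoc l _ _) ⟩
  l + areaFrom (suc p) bl + areaFrom (p + suc l) rest
    ≡⟨ sym (areaFrom-block p bl rest) ⟩
  areaFrom p (p + suc l ∷ bl ++ rest) ∎
  where
  open ≤-Reasoning
  l : ℕ
  l = length bl

areaFrom≤areaᶜ+slackᶜ : ∀ {n p hs α} → Blocks p hs α → All (_≤ n) hs → p + sum α ≡ n →
                        areaFrom p hs ≤ areaᶜ α + slackᶜ α
areaFrom≤areaᶜ+slackᶜ [] _ _ = z≤n
areaFrom≤areaᶜ+slackᶜ {n} {p} (block {rest = rest} {α} bl refl b) (_ ∷ ≤n) p+sum≡n = begin
  areaFrom p (p + suc l ∷ bl ++ rest)
    ≡⟨ areaFrom-block p bl rest ⟩
  l + areaFrom (suc p) bl + areaFrom (p + suc l) rest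
    ≤⟨ +-mono-≤ (+-monoʳ-≤ l (areaFrom≤ n (suc p) bl (All.++⁻ˡ bl ≤n) block-top≤n))
                (areaFrom≤areaᶜ+slackᶜ b (All.++⁻ʳ bl ≤n) rest-sum≡n) ⟩
  l + (triangle l + l * (n ∸ (suc p + l))) + (areaᶜ α + slackᶜ α)
    ≡⟨ cong (λ r → l + (triangle l + l * r) + (areaᶜ α + slackᶜ α)) above-block≡ ⟩
  l + (triangle l + l * sum α) + (areaᶜ α + slackᶜ α)
    ≡⟨ regroup l (triangle l) (l * sum α) (areaᶜ α) (slackᶜ α) ⟩
  l + triangle l + areaᶜ α + (l * sum α + slackᶜ α) ∎
  where
  open ≤-Reasoning
  l : ℕ
  l = length bl
  rest-sum≡n : p + suc l + sum α ≡ n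
  rest-sum≡n = trans (+-assoc p (suc l) (sum α)) p+sum≡n
  block-top≤n : suc p + l ≤ n
  block-top≤n = ≤-trans (≤-reflexive (sym (+-suc p l))) (≤-trans (m≤m+n _ (sum α)) (≤-reflexive rest-sum≡n))
  above-block≡ : n ∸ (suc p + l) ≡ sum α
  above-block≡ = trans (cong (n ∸_) (sym (+-suc p l)))
                       (trans (cong (_∸ (p + suc l)) (sym rest-sum≡n)) (m+n∸m≡n (p + suc l) (sum α)))
  regroup : ∀ l t ls a s → l + (t + ls) + (a + s) ≡ l + t + a + (ls + s)
  regroup = solve-∀

bounceHeights : ℕ → List ℕ → List ℕ
bounceHeights p []      = []
bounceHeights p (a ∷ α) = replicate a (p + a) ++ bounceHeights (p + a) α

areaFrom≡areaᶜ⇒bounceHeights : ∀ {p hs α} → Blocks p hs α → AllPairs _≤_ hs → areaFrom p hs ≡ areaᶜ α →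
                               hs ≡ bounceHeights p α
areaFrom≡areaᶜ⇒bounceHeights [] _ _ = refl
areaFrom≡areaᶜ⇒bounceHeights {p} (block {rest = rest} {α} bl refl b) (x≤ ∷ sorted) area≡ =
  cong (p + suc l ∷_) (cong₂ _++_ bl≡ (areaFrom≡areaᶜ⇒bounceHeights b sorted′ (proj₂ parts)))
  where
  l : ℕ
  l = length bl
  floor : All (suc p + l ≤_) bl
  floor = block-floor p bl x≤
  sorted′ : AllPairs _≤_ rest
  sorted′ = sorted-++⁻ʳ bl sorted
  parts : areaFrom (suc p) bl ≡ triangle l × areaFrom (p + suc l) rest ≡ areaᶜ α
  parts = +-≡-squeeze (triangle≤areaFrom (suc p) bl floor) (areaᶜ≤areaFrom b sorted′)
    (+-cancelˡ-≡ l _ _ (begin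
      l + (areaFrom (suc p) bl + areaFrom (p + suc l) rest)  ≡⟨ sym (+-assoc l _ _) ⟩
      l + areaFrom (suc p) bl + areaFrom (p + suc l) rest    ≡⟨ sym (areaFrom-block p bl rest) ⟩
      areaFrom p (p + suc l ∷ bl ++ rest)                    ≡⟨ area≡ ⟩
      l + triangle l + areaᶜ α                               ≡⟨ +-assoc l _ _ ⟩
      l + (triangle l + areaᶜ α)                             ∎))
    where open ≡-Reasoning
  bl≡ : bl ≡ replicate l (p + suc l)
  bl≡ = trans (areaFrom≡triangle⇒replicate (suc p) bl floor (proj₁ parts)) (cong (replicate l) (sym (+-suc p l)))

areaᶜ≤area : ∀ {n π} → IsDyck n π → areaᶜ (bounceComp n π) ≤ area π
areaᶜ≤area {n} {π} dyck = areaᶜ≤areaFrom (dyck-blocks {n} {π} dyck) (heightsFrom-sorted 0 π)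

area≤areaᶜ+slackᶜ : ∀ {n π} → IsDyck n π → area π ≤ areaᶜ (bounceComp n π) + slackᶜ (bounceComp n π)
area≤areaᶜ+slackᶜ {n} {π} dyck = areaFrom≤areaᶜ+slackᶜ (dyck-blocks {n} {π} dyck) (dyck-heights≤ {n} {π} dyck)
                                                       (proj₂ (bounceComp-composition {n} {π} dyck))

-- Bounce paths

heightsFrom-N^ : ∀ y a s → heightsFrom y (replicate a N ++ s) ≡ heightsFrom (y + a) s
heightsFrom-N^ y zero    s = cong (λ z → heightsFrom z s) (sym (+-identityʳ y))
heightsFrom-N^ y (suc a) s = trans (heightsFrom-N^ (suc y) a s) (cong (λ z → heightsFrom z s) (sym (+-suc y a)))

heightsFrom-E^ : ∀ y a s → heightsFrom y (replicate a E ++ s) ≡ replicate a y ++ heightsFrom y s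
heightsFrom-E^ y zero    s = refl
heightsFrom-E^ y (suc a) s = cong (y ∷_) (heightsFrom-E^ y a s)

heightsFrom-bouncePath : ∀ y α → heightsFrom y (bouncePath α) ≡ bounceHeights y α
heightsFrom-bouncePath y []      = refl
heightsFrom-bouncePath y (a ∷ α) = begin
  heightsFrom y ((replicate a N ++ replicate a E) ++ bouncePath α)
    ≡⟨ cong (heightsFrom y) (++-assoc (replicate a N) (replicate a E) (bouncePath α)) ⟩
  heightsFrom y (replicate a N ++ replicate a E ++ bouncePath α)
    ≡⟨ heightsFrom-N^ y a _ ⟩
  heightsFrom (y + a) (replicate a E ++ bouncePath α)
    ≡⟨ heightsFrom-E^ (y + a) a _ ⟩
  replicate a (y + a) ++ heightsFrom (y + a) (bouncePath α)
    ≡⟨ cong (replicate a (y + a) ++_) (heightsFrom-bouncePath (y + a) α) ⟩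
  bounceHeights y (a ∷ α) ∎
  where open ≡-Reasoning

Ballot-N^ : ∀ {k} a s → Ballot (a + k) s → Ballot k (replicate a N ++ s)
Ballot-N^     zero    s b = b
Ballot-N^ {k} (suc a) s b = Ballot-N^ a s (subst (λ j → Ballot j s) (sym (+-suc a k)) b)

Ballot-E^ : ∀ {k} a s → Ballot k s → Ballot (a + k) (replicate a E ++ s)
Ballot-E^ zero    s b = b
Ballot-E^ (suc a) s b = Ballot-E^ a s b

bouncePath-ballot : ∀ α → Ballot 0 (bouncePath α)
bouncePath-ballot []      = refl
bouncePath-ballot (a ∷ α) =
  subst (Ballot 0) (sym (++-assoc (replicate a N) (replicate a E) (bouncePath α)))
        (Ballot-N^ a _ (Ballot-E^ a _ (bouncePath-ballot α)))

blocks-bounceHeights : ∀ p α → All (1 ≤_) α → Blocks p (bounceHeights p α) α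
blocks-bounceHeights p []          []       = []
blocks-bounceHeights p (suc a ∷ α) (_ ∷ α⁺) =
  block (replicate a (p + suc a)) (length-replicate a) (blocks-bounceHeights (p + suc a) α α⁺)

bouncePath-blocks : ∀ {α} → All (1 ≤_) α → Blocks 0 (heights (bouncePath α)) α
bouncePath-blocks {α} α⁺ = subst (λ hs → Blocks 0 hs α) (sym (heightsFrom-bouncePath 0 α)) (blocks-bounceHeights 0 α α⁺)

bouncePath-dyck : ∀ {n α} → IsComposition n α → IsDyck n (bouncePath α)
bouncePath-dyck {n} {α} (α⁺ , sum≡n) = length≡ , bouncePath-ballot α
  where
  π : List Step
  π = bouncePath α
  heights-length : length (heights π) ≡ n
  heights-length = trans (blocks-sum (bouncePath-blocks α⁺)) sum≡n
  length≡ : length π ≡ n + n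
  length≡ = begin
    length π                                    ≡⟨ length≡northSteps+length-heightsFrom 0 π ⟩
    northSteps π + length (heights π)           ≡⟨ cong (_+ length (heights π)) (sym (length-heightsFrom π (bouncePath-ballot α))) ⟩
    length (heights π) + length (heights π)     ≡⟨ cong₂ _+_ heights-length heights-length ⟩
    n + n                                       ∎
    where open ≡-Reasoning

areaFrom-bounceHeights : ∀ p α → areaFrom p (bounceHeights p α) ≡ areaᶜ α
areaFrom-bounceHeights p []      = refl
areaFrom-bounceHeights p (a ∷ α) = begin
  areaFrom p (replicate a (p + a) ++ bounceHeights (p + a) α)
    ≡⟨ areaFrom-++ p (replicate a (p + a)) _ ⟩
  areaFrom p (replicate a (p + a)) + areaFrom (p + length (replicate a (p + a))) (bounceHeights (p + a) α)
    ≡⟨ cong₂ _+_ (areaFrom-replicate p a)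
                 (trans (cong (λ l → areaFrom (p + l) (bounceHeights (p + a) α)) (length-replicate a)) (areaFrom-bounceHeights (p + a) α)) ⟩
  triangle a + areaᶜ α ∎
  where open ≡-Reasoning

area-bouncePath : ∀ α → area (bouncePath α) ≡ areaᶜ α
area-bouncePath α = trans (cong (areaFrom 0) (heightsFrom-bouncePath 0 α)) (areaFrom-bounceHeights 0 α)

bounce-bouncePath : ∀ {n α} → IsComposition n α → bounce n (bouncePath α) ≡ bounceᶜ α
bounce-bouncePath {α = α} (α⁺ , sum≡n) = bounce-blocks {π = bouncePath α} (bouncePath-blocks α⁺) sum≡n

heightsFrom-nonempty : ∀ {k y} s → Ballot (suc k) s → heightsFrom y s ≢ []
heightsFrom-nonempty (N ∷ s) b = heightsFrom-nonempty s b
heightsFrom-nonempty (E ∷ s) b ()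

heightsFrom-suc≢ : ∀ y s {hs} → heightsFrom (suc y) s ≢ y ∷ hs
heightsFrom-suc≢ y s eq = <-irrefl refl (All.head (subst (All (suc y ≤_)) eq (heightsFrom-≥ (suc y) s)))

heightsFrom-injective : ∀ {k y} s t → Ballot k s → Ballot k t → heightsFrom y s ≡ heightsFrom y t → s ≡ t
heightsFrom-injective []      []      _    _    _  = refl
heightsFrom-injective []      (N ∷ t) refl bt   eq = ⊥-elim (heightsFrom-nonempty t bt (sym eq))
heightsFrom-injective (N ∷ s) []      bs   refl eq = ⊥-elim (heightsFrom-nonempty s bs eq)
heightsFrom-injective (N ∷ s) (N ∷ t) bs   bt   eq = cong (N ∷_) (heightsFrom-injective s t bs bt eq)
heightsFrom-injective {suc k} (E ∷ s) (E ∷ t) bs bt eq =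
  cong (E ∷_) (heightsFrom-injective s t bs bt (∷-injectiveʳ eq))
heightsFrom-injective {y = y} (N ∷ s) (E ∷ t) _ _ eq = ⊥-elim (heightsFrom-suc≢ y s eq)
heightsFrom-injective {y = y} (E ∷ s) (N ∷ t) _ _ eq = ⊥-elim (heightsFrom-suc≢ y t (sym eq))

area≡areaᶜ⇒bouncePath : ∀ {n π} → IsDyck n π → area π ≡ areaᶜ (bounceComp n π) → π ≡ bouncePath (bounceComp n π)
area≡areaᶜ⇒bouncePath {n} {π} dyck@(_ , ballot) area≡ =
  heightsFrom-injective π (bouncePath α) ballot (bouncePath-ballot α)
    (trans (areaFrom≡areaᶜ⇒bounceHeights (dyck-blocks {n} {π} dyck) (heightsFrom-sorted 0 π) area≡)
           (sym (heightsFrom-bouncePath 0 α)))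
  where
  α : List ℕ
  α = bounceComp n π

-- Paths in 𝒜(n)

dyck-area+bounce≤triangle : ∀ {n π} → IsDyck n π → area π + bounce n π ≤ triangle n
dyck-area+bounce≤triangle {n} {π} dyck = begin
  area π + bounce n π             ≤⟨ +-monoˡ-≤ (bounce n π) (area≤areaᶜ+slackᶜ {n} {π} dyck) ⟩
  areaᶜ α + slackᶜ α + bounce n π ≡⟨ cong (areaᶜ α + slackᶜ α +_) (bounce≡bounceᶜ {n} {π} dyck) ⟩
  areaᶜ α + slackᶜ α + bounceᶜ α  ≡⟨ +-assoc (areaᶜ α) _ _ ⟩
  areaᶜ α + (slackᶜ α + bounceᶜ α) ≡⟨ cong (areaᶜ α +_) (+-comm (slackᶜ α) _) ⟩
  areaᶜ α + (bounceᶜ α + slackᶜ α) ≡⟨ sym (+-assoc (areaᶜ α) _ _) ⟩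
  areaᶜ α + bounceᶜ α + slackᶜ α  ≡⟨ area+bounce+slack≡triangle (proj₁ α-comp) ⟩
  triangle (sum α)                ≡⟨ cong triangle (proj₂ α-comp) ⟩
  triangle n                      ∎
  where
  open ≤-Reasoning
  α : List ℕ
  α = bounceComp n π
  α-comp : IsComposition n α
  α-comp = bounceComp-composition {n} {π} dyck

InA⇒area≤areaᶜ : ∀ {n π β} → InA n π → IsComposition n β →
                 areaᶜ β + bounceᶜ β ≤ area π + bounce n π → area π ≤ areaᶜ β
InA⇒area≤areaᶜ {n} {π} {β} (dyck , minimal) β-comp total≤
  with γ , γ-comp , total≡ , area≤ ← raise-area+bounce _ β-comp
         (≤-trans (≤-reflexive (m+[n∸m]≡n total≤)) (dyck-area+bounce≤triangle {n} {π} dyck))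
  = begin
    area π               ≤⟨ minimal (bouncePath γ) (bouncePath-dyck γ-comp) same-total ⟩
    area (bouncePath γ)  ≡⟨ area-bouncePath γ ⟩
    areaᶜ γ              ≤⟨ area≤ ⟩
    areaᶜ β              ∎
  where
  open ≤-Reasoning
  same-total : area (bouncePath γ) + bounce n (bouncePath γ) ≡ area π + bounce n π
  same-total = trans (cong₂ _+_ (area-bouncePath γ) (bounce-bouncePath γ-comp)) (trans total≡ (m+[n∸m]≡n total≤))

InA⇒area≡areaᶜ : ∀ {n π} → InA n π → area π ≡ areaᶜ (bounceComp n π)
InA⇒area≡areaᶜ {n} {π} inA@(dyck , _) = ≤-antisym
  (InA⇒area≤areaᶜ {n} {π} inA (bounceComp-composition {n} {π} dyck)
    (+-mono-≤ (areaᶜ≤area {n} {π} dyck) (≤-reflexive (sym (bounce≡bounceᶜ {n} {π} dyck)))))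
  (areaᶜ≤area {n} {π} dyck)

InA⇒AreaMinimal : ∀ {n π} → InA n π → AreaMinimal (bounceComp n π)
InA⇒AreaMinimal {n} {π} inA@(dyck , _) β β≻α =
  <⇒≱ (subst (areaᶜ β <_) (sym area≡) area<)
      (InA⇒area≤areaᶜ {n} {π} inA (positive , trans sum≡ (proj₂ (bounceComp-composition {n} {π} dyck))) total≤)
  where
  open _Improves_ β≻α
  area≡ : area π ≡ areaᶜ (bounceComp n π)
  area≡ = InA⇒area≡areaᶜ {n} {π} inA
  total≤ : areaᶜ β + bounceᶜ β ≤ area π + bounce n π
  total≤ = ≤-trans area+bounce≤ (≤-reflexive (sym (cong₂ _+_ area≡ (bounce≡bounceᶜ {n} {π} dyck))))

lemma4p11 : (n : ℕ) (π : List Step) → InA n π →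
    InC n π
    × ((i j : Fin (length (bounceComp n π))) → toℕ j ≡ suc (toℕ i) →
         ∣ lookup (bounceComp n π) i - lookup (bounceComp n π) j ∣ ≤ 1)
    × ((i : Fin (length (bounceComp n π))) → suc (toℕ i) ≡ length (bounceComp n π) →
         lookup (bounceComp n π) i ≡ 1)
    × ¬ (∃[ i ] ∃[ j ] ∃[ k ] (toℕ i < toℕ j × toℕ j < toℕ k
           × lookup (bounceComp n π) i < lookup (bounceComp n π) j
           × lookup (bounceComp n π) j < lookup (bounceComp n π) k))
lemma4p11 n π inA@(dyck , _) =
  (α , α-comp , area≡areaᶜ⇒bouncePath {n} {π} dyck (InA⇒area≡areaᶜ {n} {π} inA)) ,
  AreaMinimal⇒adjacent-close α⁺ minimal ,
  AreaMinimal⇒last≡1 α⁺ minimal ,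
  AreaMinimal⇒no-increasing-triple α⁺ minimal
  where
  α : List ℕ
  α = bounceComp n π
  α-comp : IsComposition n α
  α-comp = bounceComp-composition {n} {π} dyck
  α⁺ : All (1 ≤_) α
  α⁺ = proj₁ α-comp
  minimal : AreaMinimal α
  minimal = InA⇒AreaMinimal {n} {π} inA
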